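{- Let $G$ be a connected graph with infinite node set and $^{*}G$ its enlargement with respect to a free ultrafilter $\mathcal F$ on $\mathbb N$, with principal galaxy $\Gamma_0$, and suppose $^{*}G$ has a hypernode not in $\Gamma_0$. Then the set of galaxies of $^{*}G$ is partially ordered according to closeness to $\Gamma_0$: the relation "$\Gamma_a=\Gamma_b$ or $\Gamma_a$ is closer to $\Gamma_0$ than is $\Gamma_b$" is reflexive, antisymmetric and transitive.
   Context: $G=\{X,B\}$ is a connected graph (branches are two-element subsets of $X$), $X$ infinite; $d$ is the shortest-path distance. Hypernodes are classes $[x_n]$ of sequences of nodes modulo $\langle x_n\rangle\sim\langle y_n\rangle$ iff $\{n:x_n=y_n\}\in\mathcal F$; standard hypernodes have constant representatives. Hyperbranches are classes $[\{x_n,y_n\}]$ with $\{n:\{x_n,y_n\}\in B\}\in\mathcal F$. Hypernodes $[x_n],[y_n]$ are limitedly distant if $\{n:d(x_n,y_n)\le k\}\in\mathcal F$ for some $k\in\mathbb N$; equivalence classes are nodal galaxies, and a galaxy consists of a nodal galaxy together with all hyperbranches with both ends in it. $\Gamma_0$ is the galaxy containing the standard hypernodes. For galaxies $\Gamma_a,\Gamma_b$, $\Gamma_a$ is closer to $\Gamma_0$ than is $\Gamma_b$ if there are $\mathbf y=[y_n]$ in $\Gamma_a$, $\mathbf z=[z_n]$ in $\Gamma_b$ and $\mathbf x=[x_n]$ in $\Gamma_0$ such that for every $m\in\mathbb N$, $\{n:d(z_n,x_n)-d(y_n,x_n)\ge m\}\in\mathcal F$. -}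

module Defs where

open import Level using (0ℓ)
open import Data.Nat using (ℕ; zero; suc; _+_; _≤_)
open import Data.Fin using (Fin)
open import Data.Product using (Σ; ∃; _×_; _,_)
open import Data.Empty using (⊥)
open import Data.Sum using (_⊎_)
open import Relation.Nullary using (¬_)
open import Relation.Unary using (Pred; _⊆_; _∩_; ∁; U)
open import Relation.Binary.PropositionalEquality using (_≡_; _≢_)
open import Function.Definitions using (Surjective)

Infinite : Set → Set
Infinite X = ∀ (n : ℕ) (f : Fin n → X) → ¬ Surjective _≡_ _≡_ f

record FreeUltrafilter : Set₁ where
  field
    _∈F        : Pred ℕ 0ℓ → Set
    whole      : U ∈F
    empty∉     : ¬ ((λ _ → ⊥) ∈F)
    upward     : ∀ {A B : Pred ℕ 0ℓ} → A ⊆ B → A ∈F → B ∈F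
    intersect  : ∀ {A B : Pred ℕ 0ℓ} → A ∈F → B ∈F → (A ∩ B) ∈F
    ultra      : ∀ (A : Pred ℕ 0ℓ) → A ∈F ⊎ (∁ A) ∈F
    free       : ∀ (k : ℕ) → ¬ ((λ n → n ≡ k) ∈F)

-- A (simple) graph: node type X, branch relation B which is symmetric and
-- irreflexive (branches are two-element subsets of X).
record Graph : Set₁ where
  field
    Node   : Set
    Branch : Node → Node → Set
    sym    : ∀ {x y} → Branch x y → Branch y x
    irrefl : ∀ {x} → ¬ Branch x x

module _ (G : Graph) where
  open Graph G

  data Walk : Node → Node → ℕ → Set where
    [] : ∀ {x} → Walk x x zero
    _∷_ : ∀ {x y z k} → Branch x y → Walk y z k → Walk x z (suc k)

  Connected : Set
  Connected = ∀ x y → ∃ λ k → Walk x y k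

  IsShortestPathDistance : (Node → Node → ℕ) → Set
  IsShortestPathDistance d =
    ∀ x y → Walk x y (d x y) × (∀ k → Walk x y k → d x y ≤ k)

module Enlargement (G : Graph) (F : FreeUltrafilter)
                   (d : Graph.Node G → Graph.Node G → ℕ) where
  open Graph G
  open FreeUltrafilter F

  -- representatives of hypernodes
  HyperSeq : Set
  HyperSeq = ℕ → Node

  _≈ₕ_ : HyperSeq → HyperSeq → Set
  x ≈ₕ y = (λ n → x n ≡ y n) ∈F

  -- limitedly distant hypernodes (same nodal galaxy)
  LimDist : HyperSeq → HyperSeq → Set
  LimDist x y = ∃ λ k → (λ n → d (x n) (y n) ≤ k) ∈F

  standard : Node → HyperSeq
  standard c = λ _ → c

  InΓ₀ : HyperSeq → Set
  InΓ₀ x = ∃ λ c → LimDist x (standard c)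

  -- Galaxies are represented by any of their hypernodes; two representatives
  -- denote the same galaxy iff LimDist.  "Γ(a) is closer to Γ₀ than Γ(b)":
  Closer : HyperSeq → HyperSeq → Set
  Closer a b = Σ HyperSeq λ y → Σ HyperSeq λ z → Σ HyperSeq λ x →
    LimDist y a × LimDist z b × InΓ₀ x ×
    (∀ (m : ℕ) → (λ n → m + d (y n) (x n) ≤ d (z n) (x n)) ∈F)

  _≼_ : HyperSeq → HyperSeq → Set
  a ≼ b = LimDist a b ⊎ Closer a b

-- Only the metric axioms of d matter. Both Γ(a) = Γ(b) and closeness are invariant
-- under moving the witnesses within their galaxies, because a limited change of an
-- endpoint changes distances only by a limited amount, while closeness asks for an
-- unlimited difference. This makes closeness transitive; and it is irreflexive,
-- since a hypernode cannot be unlimitedly farther from x than itself.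
module Submission where

open import Defs
open import Data.Nat using (ℕ; suc; _+_; _≤_; z≤n)
open import Data.Nat.Properties
open import Data.Nat.Solver using (module +-*-Solver)
open import Data.Product using (∃; _,_; proj₁; proj₂)
open import Data.Sum using (inj₁; inj₂)
open import Data.Empty using (⊥-elim)
open import Relation.Nullary using (¬_)
open import Relation.Unary using (Pred)
open import Relation.Binary.Structures using (IsPartialOrder; IsEquivalence)
open import Relation.Binary.PropositionalEquality
  using (_≡_; refl; cong₂; subst)
open import Relation.Binary.PropositionalEquality.Properties using (isEquivalence)
open import Function.Metric.Nat.Structures using (IsMetric)

module _ (G : Graph) where
  open Graph G renaming (sym to branch-sym)

  walk-++ : ∀ {x y z k l} → Walk G x y k → Walk G y z l → Walk G x z (k + l)
  walk-++ []      w = w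
  walk-++ (b ∷ v) w = b ∷ walk-++ v w

  walk-reverse : ∀ {x y k} → Walk G x y k → Walk G y x k
  walk-reverse []                 = []
  walk-reverse {k = suc k} (b ∷ w) =
    subst (Walk G _ _) (+-comm k 1) (walk-++ (walk-reverse w) (branch-sym b ∷ []))

  walk-zero⇒≡ : ∀ {x y} → Walk G x y 0 → x ≡ y
  walk-zero⇒≡ [] = refl

  shortestPath-isMetric : ∀ {d} → IsShortestPathDistance G d → IsMetric _≡_ d
  shortestPath-isMetric {d} sp = record
    { isSemiMetric = record
      { isQuasiSemiMetric = record
        { isPreMetric = record
          { isProtoMetric = record
            { isPartialOrder  = ≤-isPartialOrder
            ; ≈-isEquivalence = isEquivalence
            ; cong            = cong₂ d
            ; nonNegative     = z≤n
            }
          ; ≈⇒0 = λ { {x} refl → n≤0⇒n≡0 (minimal x x 0 []) }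
          }
        ; 0⇒≈ = λ {x} {y} d≡0 → walk-zero⇒≡ (subst (Walk G x y) d≡0 (geodesic x y))
        }
      ; sym = λ x y → ≤-antisym (reverse-≤ x y) (reverse-≤ y x)
      }
    ; triangle = λ x y z → minimal x z _ (walk-++ (geodesic x y) (geodesic y z))
    }
    where
    geodesic : ∀ x y → Walk G x y (d x y)
    geodesic x y = proj₁ (sp x y)

    minimal : ∀ x y k → Walk G x y k → d x y ≤ k
    minimal x y = proj₂ (sp x y)

    reverse-≤ : ∀ x y → d x y ≤ d y x
    reverse-≤ x y = minimal x y _ (walk-reverse (geodesic y x))

module _ (F : FreeUltrafilter) where
  open FreeUltrafilter F

  upward₂ : ∀ {A B C : Pred ℕ _} →
    A ∈F → B ∈F → (∀ {n} → A n → B n → C n) → C ∈F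
  upward₂ A∈F B∈F A∩B⊆C = upward (λ (a , b) → A∩B⊆C a b) (intersect A∈F B∈F)

module Galaxies (G : Graph) (F : FreeUltrafilter)
  {d : Graph.Node G → Graph.Node G → ℕ} (isMetric : IsMetric _≡_ d) where
  open FreeUltrafilter F
  open Enlargement G F d
  open IsMetric isMetric using (≈⇒0; triangle) renaming (sym to d-sym)

  limDist-isEquivalence : IsEquivalence LimDist
  limDist-isEquivalence = record
    { refl  = 0 , upward (λ {n} _ → ≤-reflexive (≈⇒0 refl)) whole
    ; sym   = λ {a} {b} (k , A) →
        k , upward (λ {n} ab≤k → subst (_≤ k) (d-sym (a n) (b n)) ab≤k) A
    ; trans = λ {a} {b} {c} (k , A) (l , B) →
        k + l , upward₂ F A B (λ {n} ab≤k bc≤l →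
          ≤-trans (triangle (a n) (b n) (c n)) (+-mono-≤ ab≤k bc≤l))
    }

  open IsEquivalence limDist-isEquivalence
    renaming (refl to limDist-refl; sym to limDist-sym; trans to limDist-trans)

  inΓ₀⇒limDist : ∀ {x x'} → InΓ₀ x → InΓ₀ x' → LimDist x x'
  inΓ₀⇒limDist (c , x~c) (c' , x'~c') =
    limDist-trans x~c
      (limDist-trans (d c c' , upward (λ _ → ≤-refl) whole) (limDist-sym x'~c'))

  Farther : HyperSeq → HyperSeq → HyperSeq → Set
  Farther y z x = ∀ m → (λ n → m + d (y n) (x n) ≤ d (z n) (x n)) ∈F

  farther-irrefl : ∀ {y x} → ¬ Farther y y x
  farther-irrefl far = empty∉ (upward (λ {n} → n≮n _) (far 1))

  farther-trans : ∀ {y z w x} → Farther y z x → Farther z w x → Farther y w x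
  farther-trans far far' m = upward₂ F (far m) (far' 0) ≤-trans

  farther-respects-far : ∀ {y z z' x} →
    LimDist z z' → Farther y z x → Farther y z' x
  farther-respects-far {y} {z} {z'} {x} (q , Q) far m =
    upward₂ F Q (far (q + m)) λ {n} zz'≤q qm-far →
      let open ≤-Reasoning in
      +-cancelˡ-≤ q _ _ (begin
        q + (m + d (y n) (x n))         ≡⟨ +-assoc q m _ ⟨
        q + m + d (y n) (x n)           ≤⟨ qm-far ⟩
        d (z n) (x n)                   ≤⟨ triangle (z n) (z' n) (x n) ⟩
        d (z n) (z' n) + d (z' n) (x n) ≤⟨ +-monoˡ-≤ _ zz'≤q ⟩
        q + d (z' n) (x n)              ∎)

  farther-respects-anchor : ∀ {y z x x'} →
    LimDist x x' → Farther y z x → Farther y z x'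
  farther-respects-anchor {y} {z} {x} {x'} (r , R) far m =
    upward₂ F R (far (m + r + r)) λ {n} xx'≤r mrr-far →
      let open ≤-Reasoning in
      +-cancelʳ-≤ r _ _ (begin
        m + d (y n) (x' n) + r          ≤⟨ +-monoˡ-≤ r (+-monoʳ-≤ m (begin
            d (y n) (x' n)                  ≤⟨ triangle (y n) (x n) (x' n) ⟩
            d (y n) (x n) + d (x n) (x' n)  ≤⟨ +-monoʳ-≤ _ xx'≤r ⟩
            d (y n) (x n) + r               ∎)) ⟩
        m + (d (y n) (x n) + r) + r     ≡⟨ swap m (d (y n) (x n)) r ⟩
        m + r + r + d (y n) (x n)       ≤⟨ mrr-far ⟩
        d (z n) (x n)                   ≤⟨ triangle (z n) (x' n) (x n) ⟩
        d (z n) (x' n) + d (x' n) (x n) ≡⟨ cong₂ _+_ refl (d-sym (x' n) (x n)) ⟩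
        d (z n) (x' n) + d (x n) (x' n) ≤⟨ +-monoʳ-≤ _ xx'≤r ⟩
        d (z n) (x' n) + r              ∎)
    where
    open +-*-Solver
    swap : ∀ m Y r → m + (Y + r) + r ≡ m + r + r + Y
    swap = solve 3 (λ m Y r → m :+ (Y :+ r) :+ r := m :+ r :+ r :+ Y) refl

  closer-respectsʳ : ∀ {a b c} → Closer a b → LimDist b c → Closer a c
  closer-respectsʳ (y , z , x , y~a , z~b , x∈Γ₀ , far) b~c =
    y , z , x , y~a , limDist-trans z~b b~c , x∈Γ₀ , far

  closer-respectsˡ : ∀ {a b c} → LimDist a b → Closer b c → Closer a c
  closer-respectsˡ a~b (y , z , x , y~b , z~c , x∈Γ₀ , far) =
    y , z , x , limDist-trans y~b (limDist-sym a~b) , z~c , x∈Γ₀ , far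

  closer-trans : ∀ {a b c} → Closer a b → Closer b c → Closer a c
  closer-trans (y , z , x , y~a , z~b , x∈Γ₀ , far) (y' , z' , x' , y'~b , z'~c , x'∈Γ₀ , far') =
    y , z' , x' , y~a , z'~c , x'∈Γ₀ ,
    farther-trans
      (farther-respects-anchor (inΓ₀⇒limDist x∈Γ₀ x'∈Γ₀)
        (farther-respects-far (limDist-trans z~b (limDist-sym y'~b)) far))
      far'

  closer⇒¬limDist : ∀ {a b} → Closer a b → ¬ LimDist a b
  closer⇒¬limDist (y , z , x , y~a , z~b , _ , far) a~b =
    farther-irrefl (farther-respects-far z~y far)
    where
    z~y = limDist-trans z~b (limDist-trans (limDist-sym a~b) (limDist-sym y~a))

  ≼-trans : ∀ {a b c} → a ≼ b → b ≼ c → a ≼ c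
  ≼-trans (inj₁ a~b) (inj₁ b~c) = inj₁ (limDist-trans a~b b~c)
  ≼-trans (inj₁ a~b) (inj₂ b<c) = inj₂ (closer-respectsˡ a~b b<c)
  ≼-trans (inj₂ a<b) (inj₁ b~c) = inj₂ (closer-respectsʳ a<b b~c)
  ≼-trans (inj₂ a<b) (inj₂ b<c) = inj₂ (closer-trans a<b b<c)

  ≼-antisym : ∀ {a b} → a ≼ b → b ≼ a → LimDist a b
  ≼-antisym (inj₁ a~b) _          = a~b
  ≼-antisym (inj₂ a<b) (inj₁ b~a) = ⊥-elim (closer⇒¬limDist a<b (limDist-sym b~a))
  ≼-antisym (inj₂ a<b) (inj₂ b<a) =
    ⊥-elim (closer⇒¬limDist (closer-trans a<b b<a) limDist-refl)

  ≼-isPartialOrder : IsPartialOrder LimDist _≼_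
  ≼-isPartialOrder = record
    { isPreorder = record
      { isEquivalence = limDist-isEquivalence
      ; reflexive     = inj₁
      ; trans         = ≼-trans
      }
    ; antisym = ≼-antisym
    }

theorem4p3 : (G : Graph) (F : FreeUltrafilter)
    (d : Graph.Node G → Graph.Node G → ℕ) →
    Infinite (Graph.Node G) →
    Connected G →
    IsShortestPathDistance G d →
    (∃ λ x → ¬ Enlargement.InΓ₀ G F d x) →
    IsPartialOrder (Enlargement.LimDist G F d) (Enlargement._≼_ G F d)
theorem4p3 G F d _ _ sp _ = Galaxies.≼-isPartialOrder G F (shortestPath-isMetric G sp)
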